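{- We have that \begin{equation*}\begin{array}{l} \sum_{k=0}^{l}(-1)^{k}(-q)^{(l-s)k-k(k+1)/2}\sum_{j=0}^{k}(-q)^{(2l+1-j)j/2}\genfrac{[}{]}{0pt}{}{l}{l-j}\genfrac{[}{]}{0pt}{}{l-j}{l-k}\\ \times \left\{ \prod_{i=0}^{s-1}(1-(-q)^{ -l+k+i}) -(-1)^s(-q)^{s(-l+k)}\prod_{i=0}^{s-1}(1-(-q)^{ -l+i})\right\} =0. \end{array} \end{equation*}
   Context: Let $q$ be a prime power, $l\geq0$ and $s\geq1$ integers. For integers $u\geq v\geq0$ define $\genfrac{[}{]}{0pt}{}{u}{v}=\dfrac{\prod_{i=1}^u(1-(-q)^{ -i})}{\prod_{i=1}^v(1-(-q)^{ -i})\prod_{i=1}^{u-v}(1-(-q)^{ -i})}$. -}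

module Defs where

open import Data.Nat as ℕ using (ℕ; zero; suc; _≤_; _∸_)
open import Data.Nat.DivMod using (_/_)
open import Data.Integer as ℤ using (ℤ; +_; -[1+_])
open import Data.Rational as ℚ using (ℚ; 0ℚ; 1ℚ; _+_; _*_; _-_; -_; 1/_; ≢-nonZero)
open import Data.Rational.Properties using (_≟_)
open import Relation.Nullary using (yes; no)

_^ℕ_ : ℚ → ℕ → ℚ
x ^ℕ zero = 1ℚ
x ^ℕ suc n = x * (x ^ℕ n)

-- total inverse (0 ↦ 0); only ever applied to nonzero values below
inv : ℚ → ℚ
inv p with p ≟ 0ℚ
... | yes _ = 0ℚ
... | no ne = 1/_ p {{≢-nonZero ne}}

_÷'_ : ℚ → ℚ → ℚ
x ÷' y = x * inv y

_^ℤ_ : ℚ → ℤ → ℚ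
x ^ℤ (+ n) = x ^ℕ n
x ^ℤ -[1+ n ] = inv (x ^ℕ suc n)

mq : ℕ → ℚ
mq q = - (+ q ℚ./ 1)

open import Data.Nat.Primality using (Prime)
open import Data.Product using (Σ; _×_)
open import Relation.Binary.PropositionalEquality using (_≡_)
IsPrimePower : ℕ → Set
IsPrimePower q = Σ ℕ λ p → Σ ℕ λ e → Prime p × 1 ≤ e × q ≡ p ℕ.^ e

Σ≤ : ℕ → (ℕ → ℚ) → ℚ
Σ≤ zero f = f 0
Σ≤ (suc n) f = Σ≤ n f + f (suc n)

Π< : ℕ → (ℕ → ℚ) → ℚ
Π< zero f = 1ℚ
Π< (suc n) f = Π< n f * f n

qfac : ℕ → ℕ → ℚ
qfac q u = Π< u (λ i → 1ℚ - (mq q ^ℤ (ℤ.- (+ suc i))))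

-- Gaussian binomial [u v] (intended for u ≥ v ≥ 0), as in the paper
gbin : ℕ → ℕ → ℕ → ℚ
gbin q u v = qfac q u ÷' (qfac q v * qfac q (u ∸ v))

tri : ℕ → ℕ
tri k = (k ℕ.* suc k) / 2

-- Put x = −q and let [n,k] be the Gaussian binomial in base 1/x. Since
-- [l,l−j][l−j,l−k] = [l,k][k,j], the q-binomial theorem turns the inner sum into
-- [l,k] ∏_{i<k} (1 + x^{l−i}), and absorption, [l,k] ∏_{i<s} (1 − x^{k−l+i}) = C [l−s,k]
-- with C = ∏_{i<s} (1 − x^{i−l}), turns the whole sum into C S(l−s) − (−1)^s x^{−sl} C S(l),
-- where S(n) = Σ_k (−1)^k x^{nk − k(k+1)/2} [n,k] ∏_{i<k} (1 + x^{l−i}). The q-Pascal rule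
-- makes S(n+1) telescope, so S(n) = (−x^l)^n and the two terms cancel. When s > l both
-- products contain the factor 1 − x^0 = 0.

{-# OPTIONS --safe #-}
module Submission where

open import Defs
open import Data.Nat using (ℕ; _≤_; _∸_; _/_)
open import Data.Nat as ℕ using ()
open import Data.Integer as ℤ using (ℤ; +_)
open import Data.Rational using (ℚ; 0ℚ; 1ℚ; _+_; _*_; _-_; -_)
open import Relation.Binary.PropositionalEquality using (_≡_)

open import Data.Empty using (⊥-elim)
open import Data.Nat using (zero; suc; z≤n; s≤s; _<_)
import Data.Nat.Properties as ℕP
open import Data.Nat.DivMod using (m*n/n≡m; +-distrib-/-∣ʳ)
open import Data.Nat.Divisibility using (n∣m*n)
open import Data.Nat.Primality using (prime⇒nonTrivial)
import Data.Nat.Coprimality as Coprimality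
import Data.Nat.Tactic.RingSolver as ℕSolver
import Data.Integer.Properties as ℤP
import Data.Integer.Tactic.RingSolver as ℤSolver
import Data.Rational as ℚ
import Data.Rational.Properties as ℚP
open import Data.Product using (_,_)
open import Data.Sum using (inj₁; inj₂; [_,_]′)
open import Level using (0ℓ)
open import Relation.Binary.PropositionalEquality
  using (refl; sym; trans; cong; cong₂; subst; _≢_; module ≡-Reasoning)
open import Relation.Nullary.Decidable using (yes; no; dec⇒maybe)
open import Tactic.RingSolver using (solve-∀)
open import Tactic.RingSolver.Core.AlmostCommutativeRing
  using (AlmostCommutativeRing; fromCommutativeRing)
open ≡-Reasoning

ℚ-ring : AlmostCommutativeRing 0ℓ 0ℓ
ℚ-ring = fromCommutativeRing ℚP.+-*-commutativeRing (λ p → dec⇒maybe (0ℚ ℚP.≟ p))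

inv-inverseˡ : ∀ p → p ≢ 0ℚ → inv p * p ≡ 1ℚ
inv-inverseˡ p p≢0 with p ℚP.≟ 0ℚ
... | yes p≡0  = ⊥-elim (p≢0 p≡0)
... | no  p≢0′ = ℚP.*-inverseˡ p {{ℚ.≢-nonZero p≢0′}}

inv-inverseʳ : ∀ p → p ≢ 0ℚ → p * inv p ≡ 1ℚ
inv-inverseʳ p p≢0 = trans (ℚP.*-comm p (inv p)) (inv-inverseˡ p p≢0)

*-≢0 : ∀ {p r} → p ≢ 0ℚ → r ≢ 0ℚ → p * r ≢ 0ℚ
*-≢0 {p} {r} p≢0 r≢0 pr≡0 = r≢0 (begin
  r                ≡⟨ ℚP.*-identityˡ r ⟨
  1ℚ * r           ≡⟨ cong (_* r) (inv-inverseˡ p p≢0) ⟨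
  (inv p * p) * r  ≡⟨ ℚP.*-assoc (inv p) p r ⟩
  inv p * (p * r)  ≡⟨ cong (inv p *_) pr≡0 ⟩
  inv p * 0ℚ       ≡⟨ ℚP.*-zeroʳ (inv p) ⟩
  0ℚ               ∎)

inv-unique : ∀ p r → r ≢ 0ℚ → p * r ≡ 1ℚ → p ≡ inv r
inv-unique p r r≢0 pr≡1 = begin
  p                ≡⟨ ℚP.*-identityʳ p ⟨
  p * 1ℚ           ≡⟨ cong (p *_) (inv-inverseʳ r r≢0) ⟨
  p * (r * inv r)  ≡⟨ ℚP.*-assoc p r (inv r) ⟨
  (p * r) * inv r  ≡⟨ cong (_* inv r) pr≡1 ⟩
  1ℚ * inv r       ≡⟨ ℚP.*-identityˡ (inv r) ⟩
  inv r            ∎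

inv-distrib-* : ∀ p r → p ≢ 0ℚ → r ≢ 0ℚ → inv (p * r) ≡ inv p * inv r
inv-distrib-* p r p≢0 r≢0 = sym (inv-unique (inv p * inv r) (p * r) (*-≢0 p≢0 r≢0) (begin
  (inv p * inv r) * (p * r)  ≡⟨ interchange (inv p) (inv r) p r ⟩
  (inv p * p) * (inv r * r)  ≡⟨ cong₂ _*_ (inv-inverseˡ p p≢0) (inv-inverseˡ r r≢0) ⟩
  1ℚ                         ∎))
  where
  interchange : ∀ a b c d → (a * b) * (c * d) ≡ (a * c) * (b * d)
  interchange = solve-∀ ℚ-ring

*-inv-cancelʳ : ∀ a {b} → b ≢ 0ℚ → a * b * inv b ≡ a
*-inv-cancelʳ a {b} b≢0 = begin
  a * b * inv b    ≡⟨ ℚP.*-assoc a b (inv b) ⟩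
  a * (b * inv b)  ≡⟨ cong (a *_) (inv-inverseʳ b b≢0) ⟩
  a * 1ℚ           ≡⟨ ℚP.*-identityʳ a ⟩
  a                ∎

*-inv-cancelˡ : ∀ a {b} → b ≢ 0ℚ → b * (inv b * a) ≡ a
*-inv-cancelˡ a {b} b≢0 = begin
  b * (inv b * a)  ≡⟨ ℚP.*-assoc b (inv b) a ⟨
  b * inv b * a    ≡⟨ cong (_* a) (inv-inverseʳ b b≢0) ⟩
  1ℚ * a           ≡⟨ ℚP.*-identityˡ a ⟩
  a                ∎

1-p≡0⇒p≡1 : ∀ {p} → 1ℚ - p ≡ 0ℚ → p ≡ 1ℚ
1-p≡0⇒p≡1 {p} 1-p≡0 = trans (doubleComplement p) (cong (λ t → 1ℚ - t) 1-p≡0)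
  where
  doubleComplement : ∀ a → a ≡ 1ℚ - (1ℚ - a)
  doubleComplement = solve-∀ ℚ-ring

^ℕ-distribˡ-+-* : ∀ x m n → x ^ℕ (m ℕ.+ n) ≡ x ^ℕ m * x ^ℕ n
^ℕ-distribˡ-+-* x zero    n = sym (ℚP.*-identityˡ (x ^ℕ n))
^ℕ-distribˡ-+-* x (suc m) n = trans (cong (x *_) (^ℕ-distribˡ-+-* x m n)) (sym (ℚP.*-assoc x (x ^ℕ m) (x ^ℕ n)))

^ℕ-*-comm : ∀ x m n → x ^ℕ (m ℕ.* n) ≡ (x ^ℕ n) ^ℕ m
^ℕ-*-comm x zero    n = refl
^ℕ-*-comm x (suc m) n = trans (^ℕ-distribˡ-+-* x n (m ℕ.* n)) (cong (x ^ℕ n *_) (^ℕ-*-comm x m n))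

^ℕ-≢0 : ∀ {x} n → x ≢ 0ℚ → x ^ℕ n ≢ 0ℚ
^ℕ-≢0 zero    x≢0 ()
^ℕ-≢0 (suc n) x≢0 = *-≢0 x≢0 (^ℕ-≢0 n x≢0)

-‿^ℕ : ∀ x n → (- x) ^ℕ n ≡ (- 1ℚ) ^ℕ n * x ^ℕ n
-‿^ℕ x zero    = refl
-‿^ℕ x (suc n) = trans (cong ((- x) *_) (-‿^ℕ x n)) (regroup x ((- 1ℚ) ^ℕ n) (x ^ℕ n))
  where
  regroup : ∀ a b c → (- a) * (b * c) ≡ (- 1ℚ * b) * (a * c)
  regroup = solve-∀ ℚ-ring

[-1]^n*[-1]^n≡1 : ∀ n → (- 1ℚ) ^ℕ n * (- 1ℚ) ^ℕ n ≡ 1ℚ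
[-1]^n*[-1]^n≡1 zero    = refl
[-1]^n*[-1]^n≡1 (suc n) = trans (square ((- 1ℚ) ^ℕ n)) ([-1]^n*[-1]^n≡1 n)
  where
  square : ∀ a → (- 1ℚ * a) * (- 1ℚ * a) ≡ a * a
  square = solve-∀ ℚ-ring

p≤p^[1+n] : ∀ {p} n → 1ℚ ℚ.≤ p → 1ℚ ℚ.≤ p ^ℕ n → p ℚ.≤ p ^ℕ suc n
p≤p^[1+n] {p} n 1≤p 1≤p^n = subst (ℚ._≤ p ^ℕ suc n) (ℚP.*-identityʳ p) (ℚP.*-monoˡ-≤-nonNeg p 1≤p^n)
  where
  instance
    p≥0 : ℚ.NonNegative p
    p≥0 = ℚ.nonNegative (ℚP.≤-trans (ℚP.nonNegative⁻¹ 1ℚ) 1≤p)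

1≤p⇒1≤p^n : ∀ {p} n → 1ℚ ℚ.≤ p → 1ℚ ℚ.≤ p ^ℕ n
1≤p⇒1≤p^n zero    _   = ℚP.≤-refl
1≤p⇒1≤p^n (suc n) 1≤p = ℚP.≤-trans 1≤p (p≤p^[1+n] n 1≤p (1≤p⇒1≤p^n n 1≤p))

1<p⇒1<p^[1+n] : ∀ {p} n → 1ℚ ℚ.< p → 1ℚ ℚ.< p ^ℕ suc n
1<p⇒1<p^[1+n] n 1<p = ℚP.<-≤-trans 1<p (p≤p^[1+n] n 1≤p (1≤p⇒1≤p^n n 1≤p))
  where
  1≤p = ℚP.<⇒≤ 1<p

∣p^n∣≡∣p∣^n : ∀ p n → ℚ.∣ p ^ℕ n ∣ ≡ ℚ.∣ p ∣ ^ℕ n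
∣p^n∣≡∣p∣^n p zero    = refl
∣p^n∣≡∣p∣^n p (suc n) = trans (ℚP.∣p*q∣≡∣p∣*∣q∣ p (p ^ℕ n)) (cong (ℚ.∣ p ∣ *_) (∣p^n∣≡∣p∣^n p n))

module IntegerPowers (x : ℚ) (x≢0 : x ≢ 0ℚ) where

  ^ℤ-neg : ∀ n → x ^ℤ (ℤ.- + n) ≡ inv (x ^ℕ n)
  ^ℤ-neg zero    = refl
  ^ℤ-neg (suc n) = refl

  ^ℤ-⊖ : ∀ m n → x ^ℤ (m ℤ.⊖ n) ≡ x ^ℕ m * inv (x ^ℕ n)
  ^ℤ-⊖ m n with ℕP.≤-<-connex n m
  ... | inj₁ n≤m = begin
    x ^ℤ (m ℤ.⊖ n)                    ≡⟨ cong (x ^ℤ_) (ℤP.⊖-≥ n≤m) ⟩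
    x ^ℕ (m ∸ n)                      ≡⟨ *-inv-cancelʳ (x ^ℕ (m ∸ n)) (^ℕ-≢0 n x≢0) ⟨
    x ^ℕ (m ∸ n) * x ^ℕ n * inv (x ^ℕ n)
      ≡⟨ cong (_* inv (x ^ℕ n)) (^ℕ-distribˡ-+-* x (m ∸ n) n) ⟨
    x ^ℕ (m ∸ n ℕ.+ n) * inv (x ^ℕ n) ≡⟨ cong (λ t → x ^ℕ t * inv (x ^ℕ n)) (ℕP.m∸n+n≡m n≤m) ⟩
    x ^ℕ m * inv (x ^ℕ n)             ∎
  ... | inj₂ m<n = begin
    x ^ℤ (m ℤ.⊖ n)                        ≡⟨ cong (x ^ℤ_) (ℤP.⊖-< m<n) ⟩
    x ^ℤ (ℤ.- + (n ∸ m))                  ≡⟨ ^ℤ-neg (n ∸ m) ⟩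
    inv (x ^ℕ (n ∸ m))                    ≡⟨ *-inv-cancelˡ (inv (x ^ℕ (n ∸ m))) (^ℕ-≢0 m x≢0) ⟨
    x ^ℕ m * (inv (x ^ℕ m) * inv (x ^ℕ (n ∸ m)))
      ≡⟨ cong (x ^ℕ m *_) (inv-distrib-* _ _ (^ℕ-≢0 m x≢0) (^ℕ-≢0 (n ∸ m) x≢0)) ⟨
    x ^ℕ m * inv (x ^ℕ m * x ^ℕ (n ∸ m))  ≡⟨ cong (λ t → x ^ℕ m * inv t) (^ℕ-distribˡ-+-* x m (n ∸ m)) ⟨
    x ^ℕ m * inv (x ^ℕ (m ℕ.+ (n ∸ m)))   ≡⟨ cong (λ t → x ^ℕ m * inv (x ^ℕ t)) (ℕP.m+[n∸m]≡n (ℕP.<⇒≤ m<n)) ⟩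
    x ^ℕ m * inv (x ^ℕ n)                 ∎

  ^ℤ-distribˡ-+-* : ∀ a b → x ^ℤ (a ℤ.+ b) ≡ x ^ℤ a * x ^ℤ b
  ^ℤ-distribˡ-+-* (+ m)      (+ n)      = ^ℕ-distribˡ-+-* x m n
  ^ℤ-distribˡ-+-* (+ m)      ℤ.-[1+ n ] = ^ℤ-⊖ m (suc n)
  ^ℤ-distribˡ-+-* ℤ.-[1+ m ] (+ n)      = trans (^ℤ-⊖ n (suc m)) (ℚP.*-comm (x ^ℕ n) (inv (x ^ℕ suc m)))
  ^ℤ-distribˡ-+-* ℤ.-[1+ m ] ℤ.-[1+ n ] = begin
    inv (x ^ℕ suc (suc (m ℕ.+ n)))        ≡⟨ cong (λ t → inv (x ^ℕ suc t)) (ℕP.+-suc m n) ⟨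
    inv (x ^ℕ (suc m ℕ.+ suc n))          ≡⟨ cong inv (^ℕ-distribˡ-+-* x (suc m) (suc n)) ⟩
    inv (x ^ℕ suc m * x ^ℕ suc n)         ≡⟨ inv-distrib-* _ _ (^ℕ-≢0 (suc m) x≢0) (^ℕ-≢0 (suc n) x≢0) ⟩
    inv (x ^ℕ suc m) * inv (x ^ℕ suc n)   ∎

  ^ℤ-*-cong-+ : ∀ a b c d → a ℤ.+ b ≡ c ℤ.+ d → x ^ℤ a * x ^ℤ b ≡ x ^ℤ c * x ^ℤ d
  ^ℤ-*-cong-+ a b c d eq = begin
    x ^ℤ a * x ^ℤ b    ≡⟨ ^ℤ-distribˡ-+-* a b ⟨
    x ^ℤ (a ℤ.+ b)     ≡⟨ cong (x ^ℤ_) eq ⟩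
    x ^ℤ (c ℤ.+ d)     ≡⟨ ^ℤ-distribˡ-+-* c d ⟩
    x ^ℤ c * x ^ℤ d    ∎

  ^ℤ-inverseˡ : ∀ a → x ^ℤ (ℤ.- a) * x ^ℤ a ≡ 1ℚ
  ^ℤ-inverseˡ a = trans (sym (^ℤ-distribˡ-+-* (ℤ.- a) a)) (cong (x ^ℤ_) (ℤP.+-inverseˡ a))

Σ≤-cong : ∀ n {f g : ℕ → ℚ} → (∀ k → k ≤ n → f k ≡ g k) → Σ≤ n f ≡ Σ≤ n g
Σ≤-cong zero    f≡g = f≡g 0 z≤n
Σ≤-cong (suc n) f≡g = cong₂ _+_ (Σ≤-cong n (λ k k≤n → f≡g k (ℕP.m≤n⇒m≤1+n k≤n))) (f≡g (suc n) ℕP.≤-refl)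

Σ≤-suc : ∀ n (f : ℕ → ℚ) → Σ≤ (suc n) f ≡ f 0 + Σ≤ n (λ k → f (suc k))
Σ≤-suc zero    f = refl
Σ≤-suc (suc n) f = begin
  Σ≤ (suc n) f + f (suc (suc n))                    ≡⟨ cong (_+ f (suc (suc n))) (Σ≤-suc n f) ⟩
  (f 0 + Σ≤ n (λ k → f (suc k))) + f (suc (suc n))  ≡⟨ ℚP.+-assoc (f 0) _ _ ⟩
  f 0 + Σ≤ (suc n) (λ k → f (suc k))                ∎

Σ≤-distrib-+ : ∀ n (f g : ℕ → ℚ) → Σ≤ n (λ k → f k + g k) ≡ Σ≤ n f + Σ≤ n g
Σ≤-distrib-+ zero    f g = refl
Σ≤-distrib-+ (suc n) f g = trans (cong (_+ (f (suc n) + g (suc n))) (Σ≤-distrib-+ n f g))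
                                 (interchange (Σ≤ n f) (Σ≤ n g) (f (suc n)) (g (suc n)))
  where
  interchange : ∀ a b c d → (a + b) + (c + d) ≡ (a + c) + (b + d)
  interchange = solve-∀ ℚ-ring

Σ≤-distrib-minus : ∀ n (f g : ℕ → ℚ) → Σ≤ n (λ k → f k - g k) ≡ Σ≤ n f - Σ≤ n g
Σ≤-distrib-minus zero    f g = refl
Σ≤-distrib-minus (suc n) f g = trans (cong (_+ (f (suc n) - g (suc n))) (Σ≤-distrib-minus n f g))
                                 (interchange (Σ≤ n f) (Σ≤ n g) (f (suc n)) (g (suc n)))
  where
  interchange : ∀ a b c d → (a - b) + (c - d) ≡ (a + c) - (b + d)
  interchange = solve-∀ ℚ-ring

Σ≤-*ˡ : ∀ n c (f : ℕ → ℚ) → Σ≤ n (λ k → c * f k) ≡ c * Σ≤ n f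
Σ≤-*ˡ zero    c f = refl
Σ≤-*ˡ (suc n) c f = trans (cong (_+ c * f (suc n)) (Σ≤-*ˡ n c f)) (sym (ℚP.*-distribˡ-+ c (Σ≤ n f) (f (suc n))))

Σ≤-zero : ∀ n {f : ℕ → ℚ} → (∀ k → k ≤ n → f k ≡ 0ℚ) → Σ≤ n f ≡ 0ℚ
Σ≤-zero zero    f≡0 = f≡0 0 z≤n
Σ≤-zero (suc n) f≡0 = cong₂ _+_ (Σ≤-zero n (λ k k≤n → f≡0 k (ℕP.m≤n⇒m≤1+n k≤n))) (f≡0 (suc n) ℕP.≤-refl)

Σ≤-truncate : ∀ m d {f : ℕ → ℚ} → (∀ k → m < k → f k ≡ 0ℚ) → Σ≤ (m ℕ.+ d) f ≡ Σ≤ m f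
Σ≤-truncate m zero    {f} _   = cong (λ t → Σ≤ t f) (ℕP.+-identityʳ m)
Σ≤-truncate m (suc d) {f} f≡0 = begin
  Σ≤ (m ℕ.+ suc d) f                  ≡⟨ cong (λ t → Σ≤ t f) (ℕP.+-suc m d) ⟩
  Σ≤ (m ℕ.+ d) f + f (suc (m ℕ.+ d))  ≡⟨ cong₂ _+_ (Σ≤-truncate m d f≡0) (f≡0 _ (s≤s (ℕP.m≤m+n m d))) ⟩
  Σ≤ m f + 0ℚ                         ≡⟨ ℚP.+-identityʳ (Σ≤ m f) ⟩
  Σ≤ m f                              ∎

Σ≤-telescope : ∀ n (v : ℕ → ℚ) → Σ≤ n (λ k → v (suc k) - v k) ≡ v (suc n) - v 0
Σ≤-telescope zero    v = refl
Σ≤-telescope (suc n) v = trans (cong (_+ (v (suc (suc n)) - v (suc n))) (Σ≤-telescope n v))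
                               (collapse (v (suc n)) (v 0) (v (suc (suc n))))
  where
  collapse : ∀ a b c → (a - b) + (c - a) ≡ c - b
  collapse = solve-∀ ℚ-ring

Π<-cong : ∀ n {f g : ℕ → ℚ} → (∀ i → i < n → f i ≡ g i) → Π< n f ≡ Π< n g
Π<-cong zero    f≡g = refl
Π<-cong (suc n) f≡g = cong₂ _*_ (Π<-cong n (λ i i<n → f≡g i (ℕP.m≤n⇒m≤1+n i<n))) (f≡g n ℕP.≤-refl)

Π<-zero : ∀ n {f : ℕ → ℚ} i → i < n → f i ≡ 0ℚ → Π< n f ≡ 0ℚ
Π<-zero (suc n) {f} i (s≤s i≤n) fi≡0 with ℕP.m≤n⇒m<n∨m≡n i≤n
... | inj₁ i<n  = trans (cong (_* f n) (Π<-zero n i i<n fi≡0)) (ℚP.*-zeroˡ (f n))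
... | inj₂ refl = trans (cong (Π< i f *_) fi≡0) (ℚP.*-zeroʳ (Π< i f))

[m+n*d]/d≡m/d+n : ∀ m n d .{{_ : ℕ.NonZero d}} → (m ℕ.+ n ℕ.* d) / d ≡ m / d ℕ.+ n
[m+n*d]/d≡m/d+n m n d = trans (+-distrib-/-∣ʳ m (n∣m*n n)) (cong (m / d ℕ.+_) (m*n/n≡m n d))

tri-suc : ∀ k → tri (suc k) ≡ tri k ℕ.+ suc k
tri-suc k = begin
  (suc k ℕ.* suc (suc k)) / 2        ≡⟨ cong (_/ 2) (expand k) ⟩
  (k ℕ.* suc k ℕ.+ suc k ℕ.* 2) / 2  ≡⟨ [m+n*d]/d≡m/d+n (k ℕ.* suc k) (suc k) 2 ⟩
  tri k ℕ.+ suc k                    ∎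
  where
  expand : ∀ k → suc k ℕ.* suc (suc k) ≡ k ℕ.* suc k ℕ.+ suc k ℕ.* 2
  expand = ℕSolver.solve-∀

+tri-suc : ∀ k → + tri (suc k) ≡ + tri k ℤ.+ + suc k
+tri-suc k = trans (cong +_ (tri-suc k)) (ℤP.pos-+ (tri k) (suc k))

[2l+1∸j]*j/2≡tri[j]+[l∸j]*j : ∀ {l j} → j ≤ l → ((2 ℕ.* l ℕ.+ 1 ∸ j) ℕ.* j) / 2 ≡ tri j ℕ.+ (l ∸ j) ℕ.* j
[2l+1∸j]*j/2≡tri[j]+[l∸j]*j {l} {j} j≤l = begin
  ((2 ℕ.* l ℕ.+ 1 ∸ j) ℕ.* j) / 2       ≡⟨ cong (λ t → (t ℕ.* j) / 2) 2l+1∸j≡1+j+2r ⟩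
  ((suc j ℕ.+ r ℕ.* 2) ℕ.* j) / 2       ≡⟨ cong (_/ 2) (expand j r) ⟩
  (j ℕ.* suc j ℕ.+ r ℕ.* j ℕ.* 2) / 2  ≡⟨ [m+n*d]/d≡m/d+n (j ℕ.* suc j) (r ℕ.* j) 2 ⟩
  tri j ℕ.+ r ℕ.* j                     ∎
  where
  r = l ∸ j
  expand : ∀ j r → (suc j ℕ.+ r ℕ.* 2) ℕ.* j ≡ j ℕ.* suc j ℕ.+ r ℕ.* j ℕ.* 2
  expand = ℕSolver.solve-∀
  regroup : ∀ j r → 2 ℕ.* (j ℕ.+ r) ℕ.+ 1 ≡ (suc j ℕ.+ r ℕ.* 2) ℕ.+ j
  regroup = ℕSolver.solve-∀
  2l+1∸j≡1+j+2r : 2 ℕ.* l ℕ.+ 1 ∸ j ≡ suc j ℕ.+ r ℕ.* 2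
  2l+1∸j≡1+j+2r = begin
    2 ℕ.* l ℕ.+ 1 ∸ j                  ≡⟨ cong (λ t → 2 ℕ.* t ℕ.+ 1 ∸ j) (ℕP.m+[n∸m]≡n j≤l) ⟨
    2 ℕ.* (j ℕ.+ r) ℕ.+ 1 ∸ j          ≡⟨ cong (_∸ j) (regroup j r) ⟩
    (suc j ℕ.+ r ℕ.* 2) ℕ.+ j ∸ j      ≡⟨ ℕP.m+n∸n≡m (suc j ℕ.+ r ℕ.* 2) j ⟩
    suc j ℕ.+ r ℕ.* 2                  ∎

k-[1+k+m]≡-[1+m] : ∀ k m → + k ℤ.- + suc (k ℕ.+ m) ≡ ℤ.-[1+ m ]
k-[1+k+m]≡-[1+m] k m = begin
  + k ℤ.- + suc (k ℕ.+ m)          ≡⟨ cong (λ t → + k ℤ.- (+ 1 ℤ.+ t)) (ℤP.pos-+ k m) ⟩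
  + k ℤ.- (+ 1 ℤ.+ (+ k ℤ.+ + m))  ≡⟨ cancel (+ k) (+ m) ⟩
  ℤ.- (+ 1 ℤ.+ + m)                ∎
  where
  cancel : ∀ a b → a ℤ.- (+ 1 ℤ.+ (a ℤ.+ b)) ≡ ℤ.- (+ 1 ℤ.+ b)
  cancel = ℤSolver.solve-∀

[l∸k]+[k∸j]≡l∸j : ∀ {l k j} → j ≤ k → k ≤ l → (l ∸ k) ℕ.+ (k ∸ j) ≡ l ∸ j
[l∸k]+[k∸j]≡l∸j {l} {k} {j} j≤k k≤l = sym (begin
  l ∸ j                    ≡⟨ cong (_∸ j) (ℕP.m+[n∸m]≡n k≤l) ⟨
  k ℕ.+ (l ∸ k) ∸ j        ≡⟨ ℕP.+-∸-comm (l ∸ k) j≤k ⟩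
  (k ∸ j) ℕ.+ (l ∸ k)      ≡⟨ ℕP.+-comm (k ∸ j) (l ∸ k) ⟩
  (l ∸ k) ℕ.+ (k ∸ j)      ∎)

+[m∸n]≡+m-+n : ∀ {m n} → n ≤ m → + (m ∸ n) ≡ + m ℤ.- + n
+[m∸n]≡+m-+n {m} {n} n≤m = sym (trans (ℤP.m-n≡m⊖n m n) (ℤP.⊖-≥ n≤m))

-m+n≡-[1+m∸[1+n]] : ∀ {m n} → n < m → ℤ.- + m ℤ.+ + n ≡ ℤ.-[1+ m ∸ suc n ]
-m+n≡-[1+m∸[1+n]] {m} {n} n<m = begin
  ℤ.- + m ℤ.+ + n          ≡⟨ ℤP.+-comm (ℤ.- + m) (+ n) ⟩
  + n ℤ.- + m              ≡⟨ ℤP.m-n≡m⊖n n m ⟩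
  n ℤ.⊖ m                  ≡⟨ ℤP.⊖-< n<m ⟩
  ℤ.- + (m ∸ n)            ≡⟨ cong (λ t → ℤ.- + t) (ℕP.+-∸-assoc 1 n<m) ⟩
  ℤ.-[1+ m ∸ suc n ]       ∎

binomialExp : ℤ → ℕ → ℤ
binomialExp c j = + tri j ℤ.+ + j ℤ.* (c ℤ.- + j)

binomialExp-suc : ∀ c j k → binomialExp c (suc j) ℤ.+ (+ j ℤ.- + k) ≡ (c ℤ.- + k) ℤ.+ binomialExp c j
binomialExp-suc c j k = begin
  + tri (suc j) ℤ.+ + suc j ℤ.* (c ℤ.- + suc j) ℤ.+ (+ j ℤ.- + k)
    ≡⟨ cong (λ t → t ℤ.+ + suc j ℤ.* (c ℤ.- + suc j) ℤ.+ (+ j ℤ.- + k)) (+tri-suc j) ⟩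
  + tri j ℤ.+ + suc j ℤ.+ + suc j ℤ.* (c ℤ.- + suc j) ℤ.+ (+ j ℤ.- + k)
    ≡⟨ regroup (+ tri j) c (+ j) (+ k) ⟩
  (c ℤ.- + k) ℤ.+ binomialExp c j
    ∎
  where
  regroup : ∀ t c j k → t ℤ.+ (+ 1 ℤ.+ j) ℤ.+ (+ 1 ℤ.+ j) ℤ.* (c ℤ.- (+ 1 ℤ.+ j)) ℤ.+ (j ℤ.- k)
                      ≡ (c ℤ.- k) ℤ.+ (t ℤ.+ j ℤ.* (c ℤ.- j))
  regroup = ℤSolver.solve-∀

+[[2l+1∸j]*j/2]≡binomialExp : ∀ {l j} → j ≤ l → + (((2 ℕ.* l ℕ.+ 1 ∸ j) ℕ.* j) / 2) ≡ binomialExp (+ l) j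
+[[2l+1∸j]*j/2]≡binomialExp {l} {j} j≤l = begin
  + (((2 ℕ.* l ℕ.+ 1 ∸ j) ℕ.* j) / 2)   ≡⟨ cong +_ ([2l+1∸j]*j/2≡tri[j]+[l∸j]*j j≤l) ⟩
  + (tri j ℕ.+ (l ∸ j) ℕ.* j)           ≡⟨ ℤP.pos-+ (tri j) ((l ∸ j) ℕ.* j) ⟩
  + tri j ℤ.+ + ((l ∸ j) ℕ.* j)         ≡⟨ cong (λ t → + tri j ℤ.+ t) (ℤP.pos-* (l ∸ j) j) ⟩
  + tri j ℤ.+ + (l ∸ j) ℤ.* + j         ≡⟨ cong (λ t → + tri j ℤ.+ t ℤ.* + j) (+[m∸n]≡+m-+n j≤l) ⟩
  + tri j ℤ.+ (+ l ℤ.- + j) ℤ.* + j     ≡⟨ cong (λ t → + tri j ℤ.+ t) (ℤP.*-comm (+ l ℤ.- + j) (+ j)) ⟩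
  binomialExp (+ l) j                   ∎

alternatingExp : ℕ → ℕ → ℤ
alternatingExp n k = + k ℤ.* + n ℤ.- + tri k

alternatingExp-suc : ∀ n k → alternatingExp (suc n) (suc k) ≡ + suc k ℤ.+ alternatingExp n (suc k)
alternatingExp-suc n k = regroup (+ n) (+ k) (+ tri (suc k))
  where
  regroup : ∀ n k t → (+ 1 ℤ.+ k) ℤ.* (+ 1 ℤ.+ n) ℤ.- t ≡ (+ 1 ℤ.+ k) ℤ.+ ((+ 1 ℤ.+ k) ℤ.* n ℤ.- t)
  regroup = ℤSolver.solve-∀

alternatingExp-pascal : ∀ n k → alternatingExp (suc n) (suc k) ℤ.+ (+ k ℤ.- + n) ≡ + k ℤ.+ alternatingExp n k
alternatingExp-pascal n k = begin
  + suc k ℤ.* + suc n ℤ.- + tri (suc k) ℤ.+ (+ k ℤ.- + n)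
    ≡⟨ cong (λ t → + suc k ℤ.* + suc n ℤ.- t ℤ.+ (+ k ℤ.- + n)) (+tri-suc k) ⟩
  + suc k ℤ.* + suc n ℤ.- (+ tri k ℤ.+ + suc k) ℤ.+ (+ k ℤ.- + n)
    ≡⟨ regroup (+ n) (+ k) (+ tri k) ⟩
  + k ℤ.+ alternatingExp n k
    ∎
  where
  regroup : ∀ n k t → (+ 1 ℤ.+ k) ℤ.* (+ 1 ℤ.+ n) ℤ.- (t ℤ.+ (+ 1 ℤ.+ k)) ℤ.+ (k ℤ.- n) ≡ k ℤ.+ (k ℤ.* n ℤ.- t)
  regroup = ℤSolver.solve-∀

prime-power⇒1<q : ∀ {q} → IsPrimePower q → 1 < q
prime-power⇒1<q (p , e , p-prime , 1≤e , refl) =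
  ℕP.^-monoʳ-< p (ℕ.nonTrivial⇒n>1 p {{prime⇒nonTrivial p-prime}}) 1≤e

module _ {q} (1<q : 1 < q) where

  1<∣-q∣ : 1ℚ ℚ.< ℚ.∣ mq q ∣
  1<∣-q∣ = subst (1ℚ ℚ.<_) (sym ∣-q∣≡q) (ℚ.*<* (subst (λ t → + 1 ℤ.< t) (sym (ℤP.*-identityʳ (+ q))) (ℤ.+<+ 1<q)))
    where
    coprime : Coprimality.Coprime q 1
    coprime = Coprimality.sym (Coprimality.1-coprimeTo q)
    ∣-q∣≡q : ℚ.∣ mq q ∣ ≡ ℚ.mkℚ (+ q) 0 coprime
    ∣-q∣≡q = trans (ℚP.∣-p∣≡∣p∣ (+ q ℚ./ 1)) (cong ℚ.∣_∣ (ℚP.normalize-coprime coprime))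

  -q≢0 : mq q ≢ 0ℚ
  -q≢0 -q≡0 = ℚP.<-asym 1<∣-q∣ (subst (ℚ._< 1ℚ) (sym (cong ℚ.∣_∣ -q≡0)) (ℚP.positive⁻¹ 1ℚ))

  [-q]^[1+n]≢1 : ∀ n → mq q ^ℕ suc n ≢ 1ℚ
  [-q]^[1+n]≢1 n [-q]^[1+n]≡1 = ℚP.<-irrefl refl (subst (1ℚ ℚ.<_) ∣-q∣^[1+n]≡1 (1<p⇒1<p^[1+n] n 1<∣-q∣))
    where
    ∣-q∣^[1+n]≡1 : ℚ.∣ mq q ∣ ^ℕ suc n ≡ 1ℚ
    ∣-q∣^[1+n]≡1 = trans (sym (∣p^n∣≡∣p∣^n (mq q) (suc n))) (cong ℚ.∣_∣ [-q]^[1+n]≡1)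

module _ (q : ℕ) (x≢0 : mq q ≢ 0ℚ) (x^[1+n]≢1 : ∀ n → mq q ^ℕ suc n ≢ 1ℚ) where

  x : ℚ
  x = mq q

  open IntegerPowers x x≢0

  Q : ℕ → ℚ
  Q = qfac q

  Q⁻¹ : ℕ → ℚ
  Q⁻¹ n = inv (qfac q n)

  1-x^-[1+n]≢0 : ∀ n → 1ℚ - x ^ℤ ℤ.-[1+ n ] ≢ 0ℚ
  1-x^-[1+n]≢0 n 1-x^-[1+n]≡0 = x^[1+n]≢1 n (begin
    x ^ℕ suc n                     ≡⟨ ℚP.*-identityʳ (x ^ℕ suc n) ⟨
    x ^ℕ suc n * 1ℚ                ≡⟨ cong (x ^ℕ suc n *_) (1-p≡0⇒p≡1 1-x^-[1+n]≡0) ⟨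
    x ^ℕ suc n * inv (x ^ℕ suc n)  ≡⟨ inv-inverseʳ _ (^ℕ-≢0 (suc n) x≢0) ⟩
    1ℚ                             ∎)

  qfac-≢0 : ∀ n → Q n ≢ 0ℚ
  qfac-≢0 zero    ()
  qfac-≢0 (suc n) = *-≢0 (qfac-≢0 n) (1-x^-[1+n]≢0 n)

  Q⁻¹-suc : ∀ n → Q⁻¹ (suc n) ≡ Q⁻¹ n * inv (1ℚ - x ^ℤ ℤ.-[1+ n ])
  Q⁻¹-suc n = inv-distrib-* _ _ (qfac-≢0 n) (1-x^-[1+n]≢0 n)

  gbin-quotient : ∀ {u} v w → v ℕ.+ w ≡ u → gbin q u v ≡ Q u * (Q⁻¹ v * Q⁻¹ w)
  gbin-quotient v w refl = cong (Q (v ℕ.+ w) *_) (begin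
    inv (Q v * Q (v ℕ.+ w ∸ v))  ≡⟨ cong (λ t → inv (Q v * Q t)) (ℕP.m+n∸m≡n v w) ⟩
    inv (Q v * Q w)              ≡⟨ inv-distrib-* _ _ (qfac-≢0 v) (qfac-≢0 w) ⟩
    Q⁻¹ v * Q⁻¹ w                ∎)

  gbin[n,0]≡1 : ∀ n → gbin q n 0 ≡ 1ℚ
  gbin[n,0]≡1 n = trans (cong (λ t → Q n * inv t) (ℚP.*-identityˡ (Q n))) (inv-inverseʳ _ (qfac-≢0 n))

  gbin[n,n]≡1 : ∀ n → gbin q n n ≡ 1ℚ
  gbin[n,n]≡1 n = begin
    gbin q n n            ≡⟨ gbin-quotient n 0 (ℕP.+-identityʳ n) ⟩
    Q n * (Q⁻¹ n * 1ℚ)    ≡⟨ cong (Q n *_) (ℚP.*-identityʳ (Q⁻¹ n)) ⟩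
    Q n * Q⁻¹ n           ≡⟨ inv-inverseʳ _ (qfac-≢0 n) ⟩
    1ℚ                    ∎

  gbin-pascal-suc : ∀ k m → let n = suc (k ℕ.+ m) in
    gbin q (suc n) (suc k) ≡ gbin q n (suc k) + x ^ℤ (+ k ℤ.- + n) * gbin q n k
  gbin-pascal-suc k m = begin
    gbin q (suc n) (suc k)
      ≡⟨ gbin-quotient (suc k) (suc m) (cong suc (ℕP.+-suc k m)) ⟩
    Q (suc n) * (Q⁻¹ (suc k) * Q⁻¹ (suc m))
      ≡⟨ cong₂ (λ t u → Q n * (1ℚ - t) * u) (^ℤ-distribˡ-+-* ℤ.-[1+ k ] ℤ.-[1+ m ]) (cong₂ _*_ (Q⁻¹-suc k) (Q⁻¹-suc m)) ⟩
    Q n * (1ℚ - a * b) * ((Q⁻¹ k * inv (1ℚ - a)) * (Q⁻¹ m * inv (1ℚ - b)))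
      ≡⟨ split (Q n) (Q⁻¹ k) (Q⁻¹ m) a b _ _ (inv-inverseʳ _ (1-x^-[1+n]≢0 k)) (inv-inverseʳ _ (1-x^-[1+n]≢0 m)) ⟩
    Q n * ((Q⁻¹ k * inv (1ℚ - a)) * Q⁻¹ m) + b * (Q n * (Q⁻¹ k * (Q⁻¹ m * inv (1ℚ - b))))
      ≡⟨ cong₂ (λ t u → Q n * (t * Q⁻¹ m) + b * (Q n * (Q⁻¹ k * u))) (Q⁻¹-suc k) (Q⁻¹-suc m) ⟨
    Q n * (Q⁻¹ (suc k) * Q⁻¹ m) + b * (Q n * (Q⁻¹ k * Q⁻¹ (suc m)))
      ≡⟨ cong₂ (λ t u → t + u * (Q n * (Q⁻¹ k * Q⁻¹ (suc m))))
           (gbin-quotient (suc k) m refl) (cong (x ^ℤ_) (k-[1+k+m]≡-[1+m] k m)) ⟨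
    gbin q n (suc k) + x ^ℤ (+ k ℤ.- + n) * (Q n * (Q⁻¹ k * Q⁻¹ (suc m)))
      ≡⟨ cong (λ t → gbin q n (suc k) + x ^ℤ (+ k ℤ.- + n) * t) (gbin-quotient k (suc m) (ℕP.+-suc k m)) ⟨
    gbin q n (suc k) + x ^ℤ (+ k ℤ.- + n) * gbin q n k
      ∎
    where
    n = suc (k ℕ.+ m)
    a = x ^ℤ ℤ.-[1+ k ]
    b = x ^ℤ ℤ.-[1+ m ]

    -- 1 - a b = (1 - b) + b (1 - a)
    split : ∀ Qn iQk iQm a b iA iB → (1ℚ - a) * iA ≡ 1ℚ → (1ℚ - b) * iB ≡ 1ℚ →
      Qn * (1ℚ - a * b) * ((iQk * iA) * (iQm * iB)) ≡ Qn * ((iQk * iA) * iQm) + b * (Qn * (iQk * (iQm * iB)))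
    split Qn iQk iQm a b iA iB [1-a]iA≡1 [1-b]iB≡1 = begin
      Qn * (1ℚ - a * b) * ((iQk * iA) * (iQm * iB))
        ≡⟨ expand Qn iQk iQm a b iA iB ⟩
      Qn * iQk * iQm * (iA * ((1ℚ - b) * iB) + b * iB * ((1ℚ - a) * iA))
        ≡⟨ cong₂ (λ t u → Qn * iQk * iQm * (iA * t + b * iB * u)) [1-b]iB≡1 [1-a]iA≡1 ⟩
      Qn * iQk * iQm * (iA * 1ℚ + b * iB * 1ℚ)
        ≡⟨ collect Qn iQk iQm b iA iB ⟩
      Qn * ((iQk * iA) * iQm) + b * (Qn * (iQk * (iQm * iB)))
        ∎
      where
      expand : ∀ Qn iQk iQm a b iA iB → Qn * (1ℚ - a * b) * ((iQk * iA) * (iQm * iB))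
        ≡ Qn * iQk * iQm * (iA * ((1ℚ - b) * iB) + b * iB * ((1ℚ - a) * iA))
      expand = solve-∀ ℚ-ring
      collect : ∀ Qn iQk iQm b iA iB → Qn * iQk * iQm * (iA * 1ℚ + b * iB * 1ℚ)
        ≡ Qn * ((iQk * iA) * iQm) + b * (Qn * (iQk * (iQm * iB)))
      collect = solve-∀ ℚ-ring

  gbin-pascal : ∀ {n k} → k < n →
    gbin q (suc n) (suc k) ≡ gbin q n (suc k) + x ^ℤ (+ k ℤ.- + n) * gbin q n k
  gbin-pascal {n} {k} k<n =
    subst (λ n → gbin q (suc n) (suc k) ≡ gbin q n (suc k) + x ^ℤ (+ k ℤ.- + n) * gbin q n k)
          (ℕP.m+[n∸m]≡n k<n) (gbin-pascal-suc k (n ∸ suc k))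

  -- The q-Pascal recursion in base 1/x; unlike gbin, which is junk for k > n, it vanishes there.
  qbinom : ℕ → ℕ → ℚ
  qbinom n       zero    = 1ℚ
  qbinom zero    (suc k) = 0ℚ
  qbinom (suc n) (suc k) = qbinom n (suc k) + x ^ℤ (+ k ℤ.- + n) * qbinom n k

  qbinom-vanish : ∀ {n k} → n < k → qbinom n k ≡ 0ℚ
  qbinom-vanish {zero}  {suc k} _         = refl
  qbinom-vanish {suc n} {suc k} (s≤s n<k) = begin
    qbinom n (suc k) + x ^ℤ (+ k ℤ.- + n) * qbinom n k
      ≡⟨ cong₂ (λ t u → t + x ^ℤ (+ k ℤ.- + n) * u) (qbinom-vanish (ℕP.m≤n⇒m≤1+n n<k)) (qbinom-vanish n<k) ⟩
    0ℚ + x ^ℤ (+ k ℤ.- + n) * 0ℚ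
      ≡⟨ trans (ℚP.+-identityˡ _) (ℚP.*-zeroʳ (x ^ℤ (+ k ℤ.- + n))) ⟩
    0ℚ
      ∎

  qbinom[n,n]≡1 : ∀ n → qbinom n n ≡ 1ℚ
  qbinom[n,n]≡1 zero    = refl
  qbinom[n,n]≡1 (suc n) = begin
    qbinom n (suc n) + x ^ℤ (+ n ℤ.- + n) * qbinom n n
      ≡⟨ cong₂ (λ t u → t + x ^ℤ u * qbinom n n) (qbinom-vanish (ℕP.n<1+n n)) (ℤP.+-inverseʳ (+ n)) ⟩
    0ℚ + 1ℚ * qbinom n n
      ≡⟨ cong (λ t → 0ℚ + 1ℚ * t) (qbinom[n,n]≡1 n) ⟩
    0ℚ + 1ℚ * 1ℚ
      ≡⟨⟩
    1ℚ
      ∎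

  qbinom≡gbin : ∀ {n k} → k ≤ n → qbinom n k ≡ gbin q n k
  qbinom≡gbin {n}     {zero}  _         = sym (gbin[n,0]≡1 n)
  qbinom≡gbin {suc n} {suc k} (s≤s k≤n) = [ pascal , diagonal ]′ (ℕP.m≤n⇒m<n∨m≡n k≤n)
    where
    pascal : k < n → qbinom (suc n) (suc k) ≡ gbin q (suc n) (suc k)
    pascal k<n = begin
      qbinom n (suc k) + x ^ℤ (+ k ℤ.- + n) * qbinom n k
        ≡⟨ cong₂ (λ t u → t + x ^ℤ (+ k ℤ.- + n) * u) (qbinom≡gbin k<n) (qbinom≡gbin k≤n) ⟩
      gbin q n (suc k) + x ^ℤ (+ k ℤ.- + n) * gbin q n k
        ≡⟨ gbin-pascal k<n ⟨
      gbin q (suc n) (suc k)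
        ∎
    diagonal : k ≡ n → qbinom (suc n) (suc k) ≡ gbin q (suc n) (suc k)
    diagonal refl = trans (qbinom[n,n]≡1 (suc k)) (sym (gbin[n,n]≡1 (suc k)))

  pochhammer : ℤ → ℕ → ℚ
  pochhammer c k = Π< k (λ i → 1ℚ + x ^ℤ (c ℤ.- + i))

  q-binomial-theorem : ∀ c k → Σ≤ k (λ j → x ^ℤ binomialExp c j * qbinom k j) ≡ pochhammer c k
  q-binomial-theorem c zero    = refl
  q-binomial-theorem c (suc k) = begin
    Σ≤ (suc k) F
      ≡⟨ Σ≤-suc k F ⟩
    F 0 + Σ≤ k (λ j → F (suc j))
      ≡⟨ cong (λ t → F 0 + t) (Σ≤-cong k (λ j _ → F-pascal j)) ⟩
    F 0 + Σ≤ k (λ j → H (suc j) + e * H j)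
      ≡⟨ cong (λ t → F 0 + t) (Σ≤-distrib-+ k (λ j → H (suc j)) (λ j → e * H j)) ⟩
    F 0 + (Σ≤ k (λ j → H (suc j)) + Σ≤ k (λ j → e * H j))
      ≡⟨ cong (λ t → F 0 + (Σ≤ k (λ j → H (suc j)) + t)) (Σ≤-*ˡ k e H) ⟩
    H 0 + (Σ≤ k (λ j → H (suc j)) + e * Σ≤ k H)
      ≡⟨ ℚP.+-assoc (H 0) (Σ≤ k (λ j → H (suc j))) (e * Σ≤ k H) ⟨
    H 0 + Σ≤ k (λ j → H (suc j)) + e * Σ≤ k H
      ≡⟨ cong (_+ e * Σ≤ k H) (Σ≤-suc k H) ⟨
    Σ≤ k H + x ^ℤ binomialExp c (suc k) * qbinom k (suc k) + e * Σ≤ k H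
      ≡⟨ cong₂ (λ t u → t + x ^ℤ binomialExp c (suc k) * u + e * t) (q-binomial-theorem c k) (qbinom-vanish (ℕP.n<1+n k)) ⟩
    P + x ^ℤ binomialExp c (suc k) * 0ℚ + e * P
      ≡⟨ factor P (x ^ℤ binomialExp c (suc k)) e ⟩
    P * (1ℚ + e)
      ∎
    where
    F H : ℕ → ℚ
    F j = x ^ℤ binomialExp c j * qbinom (suc k) j
    H j = x ^ℤ binomialExp c j * qbinom k j
    e = x ^ℤ (c ℤ.- + k)
    P = pochhammer c k

    factor : ∀ p a e → p + a * 0ℚ + e * p ≡ p * (1ℚ + e)
    factor = solve-∀ ℚ-ring

    F-pascal : ∀ j → F (suc j) ≡ H (suc j) + e * H j
    F-pascal j = begin
      a * (qbinom k (suc j) + d * qbinom k j)  ≡⟨ distrib a (qbinom k (suc j)) d (qbinom k j) ⟩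
      a * qbinom k (suc j) + (a * d) * qbinom k j
        ≡⟨ cong (λ t → a * qbinom k (suc j) + t * qbinom k j) a*d≡ ⟩
      a * qbinom k (suc j) + (e * x ^ℤ binomialExp c j) * qbinom k j
        ≡⟨ cong (λ t → a * qbinom k (suc j) + t) (ℚP.*-assoc e _ _) ⟩
      H (suc j) + e * H j  ∎
      where
      a = x ^ℤ binomialExp c (suc j)
      d = x ^ℤ (+ j ℤ.- + k)
      a*d≡ : a * d ≡ e * x ^ℤ binomialExp c j
      a*d≡ = ^ℤ-*-cong-+ (binomialExp c (suc j)) (+ j ℤ.- + k) (c ℤ.- + k) (binomialExp c j) (binomialExp-suc c j k)
      distrib : ∀ a b d g → a * (b + d * g) ≡ a * b + (a * d) * g
      distrib = solve-∀ ℚ-ring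

  alternatingTerm : ℤ → ℕ → ℕ → ℚ
  alternatingTerm c n k = (- 1ℚ) ^ℕ k * x ^ℤ alternatingExp n k * qbinom n k * pochhammer c k

  alternatingTerm-vanish : ∀ c {n k} → n < k → alternatingTerm c n k ≡ 0ℚ
  alternatingTerm-vanish c {n} {k} n<k = begin
    (- 1ℚ) ^ℕ k * x ^ℤ alternatingExp n k * qbinom n k * pochhammer c k
      ≡⟨ cong (λ t → (- 1ℚ) ^ℕ k * x ^ℤ alternatingExp n k * t * pochhammer c k) (qbinom-vanish n<k) ⟩
    (- 1ℚ) ^ℕ k * x ^ℤ alternatingExp n k * 0ℚ * pochhammer c k
      ≡⟨ annihilate ((- 1ℚ) ^ℕ k * x ^ℤ alternatingExp n k) (pochhammer c k) ⟩
    0ℚ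
      ∎
    where
    annihilate : ∀ a b → a * 0ℚ * b ≡ 0ℚ
    annihilate = solve-∀ ℚ-ring

  alternatingTerm-pascal : ∀ c n k → alternatingTerm c (suc n) (suc k)
    ≡ (x ^ℕ suc k * alternatingTerm c n (suc k) - x ^ℕ k * alternatingTerm c n k) - x ^ℤ c * alternatingTerm c n k
  alternatingTerm-pascal c n k = begin
    (- 1ℚ * σ) * A * (G₁ + D * G₀) * (U * (1ℚ + e))
      ≡⟨ expand σ A G₁ D G₀ U e ⟩
    (- 1ℚ * σ) * A * G₁ * (U * (1ℚ + e)) + (- 1ℚ * σ) * (A * D) * G₀ * (U * (1ℚ + e))
      ≡⟨ cong₂ (λ t u → (- 1ℚ * σ) * t * G₁ * (U * (1ℚ + e)) + (- 1ℚ * σ) * u * G₀ * (U * (1ℚ + e))) A≡ A*D≡ ⟩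
    (- 1ℚ * σ) * (x ^ℕ suc k * W₁) * G₁ * (U * (1ℚ + e)) + (- 1ℚ * σ) * (x ^ℕ k * W₀) * G₀ * (U * (1ℚ + e))
      ≡⟨ collect σ (x ^ℕ suc k) W₁ G₁ U e (x ^ℕ k) W₀ G₀ ⟩
    (x ^ℕ suc k * T₁ - x ^ℕ k * T₀) - (e * x ^ℕ k) * T₀
      ≡⟨ cong (λ t → (x ^ℕ suc k * T₁ - x ^ℕ k * T₀) - t * T₀) e*x^k≡x^c ⟩
    (x ^ℕ suc k * T₁ - x ^ℕ k * T₀) - x ^ℤ c * T₀
      ∎
    where
    σ  = (- 1ℚ) ^ℕ k
    A  = x ^ℤ alternatingExp (suc n) (suc k)
    D  = x ^ℤ (+ k ℤ.- + n)
    W₁ = x ^ℤ alternatingExp n (suc k)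
    W₀ = x ^ℤ alternatingExp n k
    G₁ = qbinom n (suc k)
    G₀ = qbinom n k
    U  = pochhammer c k
    e  = x ^ℤ (c ℤ.- + k)
    T₁ = alternatingTerm c n (suc k)
    T₀ = alternatingTerm c n k

    A≡ : A ≡ x ^ℕ suc k * W₁
    A≡ = trans (cong (x ^ℤ_) (alternatingExp-suc n k)) (^ℤ-distribˡ-+-* (+ suc k) (alternatingExp n (suc k)))

    A*D≡ : A * D ≡ x ^ℕ k * W₀
    A*D≡ = ^ℤ-*-cong-+ (alternatingExp (suc n) (suc k)) (+ k ℤ.- + n) (+ k) (alternatingExp n k) (alternatingExp-pascal n k)

    cancel : ∀ c k → c ℤ.- k ℤ.+ k ≡ c
    cancel = ℤSolver.solve-∀

    e*x^k≡x^c : e * x ^ℕ k ≡ x ^ℤ c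
    e*x^k≡x^c = trans (sym (^ℤ-distribˡ-+-* (c ℤ.- + k) (+ k))) (cong (x ^ℤ_) (cancel c (+ k)))

    expand : ∀ σ A G₁ D G₀ U e → (- 1ℚ * σ) * A * (G₁ + D * G₀) * (U * (1ℚ + e))
      ≡ (- 1ℚ * σ) * A * G₁ * (U * (1ℚ + e)) + (- 1ℚ * σ) * (A * D) * G₀ * (U * (1ℚ + e))
    expand = solve-∀ ℚ-ring

    collect : ∀ σ X₁ W₁ G₁ U e X₀ W₀ G₀ →
      (- 1ℚ * σ) * (X₁ * W₁) * G₁ * (U * (1ℚ + e)) + (- 1ℚ * σ) * (X₀ * W₀) * G₀ * (U * (1ℚ + e))
      ≡ (X₁ * ((- 1ℚ * σ) * W₁ * G₁ * (U * (1ℚ + e))) - X₀ * (σ * W₀ * G₀ * U)) - (e * X₀) * (σ * W₀ * G₀ * U)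
    collect = solve-∀ ℚ-ring

  Σ≤-alternatingTerm : ∀ c n → Σ≤ n (alternatingTerm c n) ≡ (- x ^ℤ c) ^ℕ n
  Σ≤-alternatingTerm c zero    = refl
  Σ≤-alternatingTerm c (suc n) = begin
    Σ≤ (suc n) (alternatingTerm c (suc n))
      ≡⟨ Σ≤-suc n (alternatingTerm c (suc n)) ⟩
    1ℚ + Σ≤ n (λ k → alternatingTerm c (suc n) (suc k))
      ≡⟨ cong (λ t → 1ℚ + t) (Σ≤-cong n (λ k _ → alternatingTerm-pascal c n k)) ⟩
    1ℚ + Σ≤ n (λ k → (v (suc k) - v k) - e * T k)
      ≡⟨ cong (λ t → 1ℚ + t) (Σ≤-distrib-minus n (λ k → v (suc k) - v k) (λ k → e * T k)) ⟩
    1ℚ + (Σ≤ n (λ k → v (suc k) - v k) - Σ≤ n (λ k → e * T k))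
      ≡⟨ cong₂ (λ t u → 1ℚ + (t - u)) (Σ≤-telescope n v) (Σ≤-*ˡ n e T) ⟩
    1ℚ + ((v (suc n) - 1ℚ) - e * Σ≤ n T)
      ≡⟨ cong₂ (λ t u → 1ℚ + ((t - 1ℚ) - e * u)) v[1+n]≡0 (Σ≤-alternatingTerm c n) ⟩
    1ℚ + ((0ℚ - 1ℚ) - e * (- e) ^ℕ n)
      ≡⟨ simplify e ((- e) ^ℕ n) ⟩
    (- e) ^ℕ suc n
      ∎
    where
    e = x ^ℤ c
    T = alternatingTerm c n
    v : ℕ → ℚ
    v k = x ^ℕ k * T k

    v[1+n]≡0 : v (suc n) ≡ 0ℚ
    v[1+n]≡0 = trans (cong (x ^ℕ suc n *_) (alternatingTerm-vanish c (ℕP.n<1+n n))) (ℚP.*-zeroʳ (x ^ℕ suc n))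

    simplify : ∀ e p → 1ℚ + ((0ℚ - 1ℚ) - e * p) ≡ (- e) * p
    simplify = solve-∀ ℚ-ring

  gbin-revision : ∀ {l k j} → j ≤ k → k ≤ l →
    gbin q l (l ∸ j) * gbin q (l ∸ j) (l ∸ k) ≡ qbinom l k * qbinom k j
  gbin-revision {l} {k} {j} j≤k k≤l = begin
    gbin q l (l ∸ j) * gbin q (l ∸ j) (l ∸ k)
      ≡⟨ cong₂ _*_ (gbin-quotient (l ∸ j) j (ℕP.m∸n+n≡m (ℕP.≤-trans j≤k k≤l)))
                   (gbin-quotient (l ∸ k) (k ∸ j) ([l∸k]+[k∸j]≡l∸j j≤k k≤l)) ⟩
    (Q l * (Q⁻¹ (l ∸ j) * Q⁻¹ j)) * (Q (l ∸ j) * (Q⁻¹ (l ∸ k) * Q⁻¹ (k ∸ j)))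
      ≡⟨ exchange (Q l) (Q (l ∸ j)) (Q⁻¹ (l ∸ j)) (Q k) (Q⁻¹ k) (Q⁻¹ j) (Q⁻¹ (l ∸ k)) (Q⁻¹ (k ∸ j))
                  (inv-inverseˡ _ (qfac-≢0 (l ∸ j))) (inv-inverseˡ _ (qfac-≢0 k)) ⟩
    (Q l * (Q⁻¹ k * Q⁻¹ (l ∸ k))) * (Q k * (Q⁻¹ j * Q⁻¹ (k ∸ j)))
      ≡⟨ cong₂ _*_ (gbin-quotient k (l ∸ k) (ℕP.m+[n∸m]≡n k≤l)) (gbin-quotient j (k ∸ j) (ℕP.m+[n∸m]≡n j≤k)) ⟨
    gbin q l k * gbin q k j
      ≡⟨ cong₂ _*_ (qbinom≡gbin k≤l) (qbinom≡gbin j≤k) ⟨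
    qbinom l k * qbinom k j
      ∎
    where
    exchange : ∀ c a a⁻¹ b b⁻¹ d e f → a⁻¹ * a ≡ 1ℚ → b⁻¹ * b ≡ 1ℚ →
      (c * (a⁻¹ * d)) * (a * (e * f)) ≡ (c * (b⁻¹ * e)) * (b * (d * f))
    exchange c a a⁻¹ b b⁻¹ d e f a⁻¹a≡1 b⁻¹b≡1 = begin
      (c * (a⁻¹ * d)) * (a * (e * f))  ≡⟨ pull c a a⁻¹ d e f ⟩
      (a⁻¹ * a) * (c * d * e * f)      ≡⟨ cong (_* (c * d * e * f)) (trans a⁻¹a≡1 (sym b⁻¹b≡1)) ⟩
      (b⁻¹ * b) * (c * d * e * f)      ≡⟨ push c b b⁻¹ d e f ⟩
      (c * (b⁻¹ * e)) * (b * (d * f))  ∎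
      where
      pull : ∀ c a a⁻¹ d e f → (c * (a⁻¹ * d)) * (a * (e * f)) ≡ (a⁻¹ * a) * (c * d * e * f)
      pull = solve-∀ ℚ-ring
      push : ∀ c b b⁻¹ d e f → (b⁻¹ * b) * (c * d * e * f) ≡ (c * (b⁻¹ * e)) * (b * (d * f))
      push = solve-∀ ℚ-ring

  innerSum≡qbinom*pochhammer : ∀ {l k} → k ≤ l →
    Σ≤ k (λ j → x ^ℤ (+ (((2 ℕ.* l ℕ.+ 1 ∸ j) ℕ.* j) / 2)) * gbin q l (l ∸ j) * gbin q (l ∸ j) (l ∸ k))
    ≡ qbinom l k * pochhammer (+ l) k
  innerSum≡qbinom*pochhammer {l} {k} k≤l = begin
    Σ≤ k (λ j → x ^ℤ (+ (((2 ℕ.* l ℕ.+ 1 ∸ j) ℕ.* j) / 2)) * gbin q l (l ∸ j) * gbin q (l ∸ j) (l ∸ k))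
      ≡⟨ Σ≤-cong k term≡ ⟩
    Σ≤ k (λ j → qbinom l k * (x ^ℤ binomialExp (+ l) j * qbinom k j))
      ≡⟨ Σ≤-*ˡ k (qbinom l k) _ ⟩
    qbinom l k * Σ≤ k (λ j → x ^ℤ binomialExp (+ l) j * qbinom k j)
      ≡⟨ cong (λ t → qbinom l k * t) (q-binomial-theorem (+ l) k) ⟩
    qbinom l k * pochhammer (+ l) k
      ∎
    where
    swap : ∀ a b c → a * (b * c) ≡ b * (a * c)
    swap = solve-∀ ℚ-ring
    term≡ : ∀ j → j ≤ k → x ^ℤ (+ (((2 ℕ.* l ℕ.+ 1 ∸ j) ℕ.* j) / 2)) * gbin q l (l ∸ j) * gbin q (l ∸ j) (l ∸ k)
                         ≡ qbinom l k * (x ^ℤ binomialExp (+ l) j * qbinom k j)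
    term≡ j j≤k = begin
      x ^ℤ (+ (((2 ℕ.* l ℕ.+ 1 ∸ j) ℕ.* j) / 2)) * gbin q l (l ∸ j) * gbin q (l ∸ j) (l ∸ k)
        ≡⟨ ℚP.*-assoc (x ^ℤ (+ (((2 ℕ.* l ℕ.+ 1 ∸ j) ℕ.* j) / 2))) (gbin q l (l ∸ j)) (gbin q (l ∸ j) (l ∸ k)) ⟩
      x ^ℤ (+ (((2 ℕ.* l ℕ.+ 1 ∸ j) ℕ.* j) / 2)) * (gbin q l (l ∸ j) * gbin q (l ∸ j) (l ∸ k))
        ≡⟨ cong₂ _*_ (cong (x ^ℤ_) (+[[2l+1∸j]*j/2]≡binomialExp (ℕP.≤-trans j≤k k≤l))) (gbin-revision j≤k k≤l) ⟩
      x ^ℤ binomialExp (+ l) j * (qbinom l k * qbinom k j)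
        ≡⟨ swap (x ^ℤ binomialExp (+ l) j) (qbinom l k) (qbinom k j) ⟩
      qbinom l k * (x ^ℤ binomialExp (+ l) j * qbinom k j)
        ∎

  qfalling : ℕ → ℕ → ℚ
  qfalling m s = Π< s (λ i → 1ℚ - x ^ℤ (ℤ.- + m ℤ.+ + i))

  qfalling*qfac : ∀ {m s} → s ≤ m → qfalling m s * Q (m ∸ s) ≡ Q m
  qfalling*qfac {m} {zero}  _   = ℚP.*-identityˡ (Q m)
  qfalling*qfac {m} {suc s} s<m = begin
    qfalling m s * (1ℚ - x ^ℤ (ℤ.- + m ℤ.+ + s)) * Q r
      ≡⟨ cong (λ t → qfalling m s * (1ℚ - x ^ℤ t) * Q r) (-m+n≡-[1+m∸[1+n]] s<m) ⟩
    qfalling m s * (1ℚ - x ^ℤ ℤ.-[1+ r ]) * Q r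
      ≡⟨ ℚP.*-assoc (qfalling m s) _ (Q r) ⟩
    qfalling m s * ((1ℚ - x ^ℤ ℤ.-[1+ r ]) * Q r)
      ≡⟨ cong (λ t → qfalling m s * t) (ℚP.*-comm _ (Q r)) ⟩
    qfalling m s * Q (suc r)
      ≡⟨ cong (λ t → qfalling m s * Q t) (ℕP.+-∸-assoc 1 s<m) ⟨
    qfalling m s * Q (m ∸ s)
      ≡⟨ qfalling*qfac (ℕP.<⇒≤ s<m) ⟩
    Q m
      ∎
    where
    r = m ∸ suc s

  qfalling≡quotient : ∀ {m s} → s ≤ m → qfalling m s ≡ Q m * Q⁻¹ (m ∸ s)
  qfalling≡quotient {m} {s} s≤m = begin
    qfalling m s                              ≡⟨ *-inv-cancelʳ (qfalling m s) (qfac-≢0 (m ∸ s)) ⟨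
    qfalling m s * Q (m ∸ s) * Q⁻¹ (m ∸ s)    ≡⟨ cong (_* Q⁻¹ (m ∸ s)) (qfalling*qfac s≤m) ⟩
    Q m * Q⁻¹ (m ∸ s)                         ∎

  qfalling-vanish : ∀ {m s} → m < s → qfalling m s ≡ 0ℚ
  qfalling-vanish {m} {s} m<s = Π<-zero s m m<s (cong (λ t → 1ℚ - x ^ℤ t) (ℤP.+-inverseˡ (+ m)))

  qbinom-absorb : ∀ {l s k} → s ≤ l → k ≤ l →
    qbinom l k * qfalling (l ∸ k) s ≡ qfalling l s * qbinom (l ∸ s) k
  qbinom-absorb {l} {s} {k} s≤l k≤l = [ fits , overflows ]′ (ℕP.≤-<-connex s (l ∸ k))
    where
    m = l ∸ k

    fits : s ≤ m → qbinom l k * qfalling m s ≡ qfalling l s * qbinom (l ∸ s) k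
    fits s≤m = begin
      qbinom l k * qfalling m s
        ≡⟨ cong₂ _*_ (trans (qbinom≡gbin k≤l) (gbin-quotient k m (ℕP.m+[n∸m]≡n k≤l))) (qfalling≡quotient s≤m) ⟩
      (Q l * (Q⁻¹ k * Q⁻¹ m)) * (Q m * Q⁻¹ (m ∸ s))
        ≡⟨ cancel (Q l) (Q⁻¹ k) (Q m) (Q⁻¹ m) (Q⁻¹ (m ∸ s)) (inv-inverseˡ _ (qfac-≢0 m)) ⟩
      Q l * (Q⁻¹ k * Q⁻¹ (m ∸ s))
        ≡⟨ cong (_* (Q⁻¹ k * Q⁻¹ (m ∸ s))) (qfalling*qfac s≤l) ⟨
      qfalling l s * Q (l ∸ s) * (Q⁻¹ k * Q⁻¹ (m ∸ s))
        ≡⟨ ℚP.*-assoc (qfalling l s) _ _ ⟩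
      qfalling l s * (Q (l ∸ s) * (Q⁻¹ k * Q⁻¹ (m ∸ s)))
        ≡⟨ cong (λ t → qfalling l s * t) (gbin-quotient k (m ∸ s) k+[m∸s]≡l∸s) ⟨
      qfalling l s * gbin q (l ∸ s) k
        ≡⟨ cong (λ t → qfalling l s * t) (qbinom≡gbin k≤l∸s) ⟨
      qfalling l s * qbinom (l ∸ s) k
        ∎
      where
      k≤l∸s : k ≤ l ∸ s
      k≤l∸s = ℕP.m+n≤o⇒m≤o∸n k (subst (_≤ l) (ℕP.+-comm s k) (ℕP.m≤o∸n⇒m+n≤o s k≤l s≤m))
      k+[m∸s]≡l∸s : k ℕ.+ (m ∸ s) ≡ l ∸ s
      k+[m∸s]≡l∸s = trans (sym (ℕP.+-∸-assoc k s≤m)) (cong (_∸ s) (ℕP.m+[n∸m]≡n k≤l))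
      cancel : ∀ c d a a⁻¹ e → a⁻¹ * a ≡ 1ℚ → (c * (d * a⁻¹)) * (a * e) ≡ c * (d * e)
      cancel c d a a⁻¹ e a⁻¹a≡1 = trans (regroup c d a a⁻¹ e) (trans (cong (_* (c * (d * e))) a⁻¹a≡1) (ℚP.*-identityˡ _))
        where
        regroup : ∀ c d a a⁻¹ e → (c * (d * a⁻¹)) * (a * e) ≡ (a⁻¹ * a) * (c * (d * e))
        regroup = solve-∀ ℚ-ring

    overflows : m < s → qbinom l k * qfalling m s ≡ qfalling l s * qbinom (l ∸ s) k
    overflows m<s = begin
      qbinom l k * qfalling m s       ≡⟨ cong (λ t → qbinom l k * t) (qfalling-vanish m<s) ⟩
      qbinom l k * 0ℚ                 ≡⟨ ℚP.*-zeroʳ (qbinom l k) ⟩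
      0ℚ                              ≡⟨ ℚP.*-zeroʳ (qfalling l s) ⟨
      qfalling l s * 0ℚ               ≡⟨ cong (λ t → qfalling l s * t) (qbinom-vanish l∸s<k) ⟨
      qfalling l s * qbinom (l ∸ s) k ∎
      where
      l∸s<k : l ∸ s < k
      l∸s<k = ℕP.≰⇒> (λ k≤l∸s → ℕP.<⇒≱ m<s
                (ℕP.m+n≤o⇒m≤o∸n s (subst (_≤ l) (ℕP.+-comm k s) (ℕP.m≤o∸n⇒m+n≤o k s≤l k≤l∸s))))

  summand : ℕ → ℕ → ℕ → ℚ
  summand l s k =
    ((- 1ℚ) ^ℕ k) * (x ^ℤ (((+ l ℤ.- + s) ℤ.* + k) ℤ.- + tri k))
    * Σ≤ k (λ j → (x ^ℤ (+ ((((2 ℕ.* l) ℕ.+ 1 ∸ j) ℕ.* j) / 2))) * gbin q l (l ∸ j) * gbin q (l ∸ j) (l ∸ k))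
    * (Π< s (λ i → 1ℚ - (x ^ℤ ((ℤ.- + l) ℤ.+ + k ℤ.+ + i)))
       - ((- 1ℚ) ^ℕ s) * (x ^ℤ (+ s ℤ.* ((ℤ.- + l) ℤ.+ + k))) * qfalling l s)

  shifted-qfalling : ∀ {l k} s → k ≤ l → Π< s (λ i → 1ℚ - x ^ℤ ((ℤ.- + l) ℤ.+ + k ℤ.+ + i)) ≡ qfalling (l ∸ k) s
  shifted-qfalling {l} {k} s k≤l = Π<-cong s (λ i _ → cong (λ t → 1ℚ - x ^ℤ t) (begin
    ℤ.- + l ℤ.+ + k ℤ.+ + i      ≡⟨ regroup (+ l) (+ k) (+ i) ⟩
    ℤ.- (+ l ℤ.- + k) ℤ.+ + i    ≡⟨ cong (λ t → ℤ.- t ℤ.+ + i) (+[m∸n]≡+m-+n k≤l) ⟨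
    ℤ.- + (l ∸ k) ℤ.+ + i        ∎))
    where
    regroup : ∀ l k i → ℤ.- l ℤ.+ k ℤ.+ i ≡ ℤ.- (l ℤ.- k) ℤ.+ i
    regroup = ℤSolver.solve-∀

  summand-split : ∀ {l s k} → s ≤ l → k ≤ l →
    summand l s k ≡ qfalling l s * alternatingTerm (+ l) (l ∸ s) k
                  - (- 1ℚ) ^ℕ s * x ^ℤ (ℤ.- (+ s ℤ.* + l)) * qfalling l s * alternatingTerm (+ l) l k
  summand-split {l} {s} {k} s≤l k≤l = begin
    summand l s k
      ≡⟨ cong₂ (λ t u → σ * X₁ * t * (u - σₛ * X₂ * C)) (innerSum≡qbinom*pochhammer k≤l) (shifted-qfalling s k≤l) ⟩
    σ * X₁ * (G * U) * (qfalling (l ∸ k) s - σₛ * X₂ * C)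
      ≡⟨ expand σ X₁ G U (qfalling (l ∸ k) s) σₛ X₂ C ⟩
    σ * X₁ * U * (G * qfalling (l ∸ k) s) - σₛ * C * (σ * U * G * (X₁ * X₂))
      ≡⟨ cong₂ (λ t u → σ * X₁ * U * t - σₛ * C * (σ * U * G * u)) (qbinom-absorb s≤l k≤l) X₁*X₂≡ ⟩
    σ * X₁ * U * (C * G′) - σₛ * C * (σ * U * G * (W * X⁻))
      ≡⟨ cong (λ t → σ * x ^ℤ t * U * (C * G′) - σₛ * C * (σ * U * G * (W * X⁻))) X₁-exponent ⟩
    σ * W′ * U * (C * G′) - σₛ * C * (σ * U * G * (W * X⁻))
      ≡⟨ collect σ W′ U C G′ σₛ G W X⁻ ⟩
    C * alternatingTerm (+ l) (l ∸ s) k - σₛ * X⁻ * C * alternatingTerm (+ l) l k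
      ∎
    where
    σ  = (- 1ℚ) ^ℕ k
    σₛ = (- 1ℚ) ^ℕ s
    X₁ = x ^ℤ (((+ l ℤ.- + s) ℤ.* + k) ℤ.- + tri k)
    X₂ = x ^ℤ (+ s ℤ.* ((ℤ.- + l) ℤ.+ + k))
    X⁻ = x ^ℤ (ℤ.- (+ s ℤ.* + l))
    W  = x ^ℤ alternatingExp l k
    W′ = x ^ℤ alternatingExp (l ∸ s) k
    G  = qbinom l k
    G′ = qbinom (l ∸ s) k
    U  = pochhammer (+ l) k
    C  = qfalling l s

    X₁-exponent : ((+ l ℤ.- + s) ℤ.* + k) ℤ.- + tri k ≡ alternatingExp (l ∸ s) k
    X₁-exponent = begin
      (+ l ℤ.- + s) ℤ.* + k ℤ.- + tri k   ≡⟨ cong (λ t → t ℤ.* + k ℤ.- + tri k) (+[m∸n]≡+m-+n s≤l) ⟨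
      + (l ∸ s) ℤ.* + k ℤ.- + tri k       ≡⟨ cong (ℤ._- + tri k) (ℤP.*-comm (+ (l ∸ s)) (+ k)) ⟩
      alternatingExp (l ∸ s) k            ∎

    exponents : ∀ l s k t → (l ℤ.- s) ℤ.* k ℤ.- t ℤ.+ s ℤ.* (ℤ.- l ℤ.+ k) ≡ k ℤ.* l ℤ.- t ℤ.+ ℤ.- (s ℤ.* l)
    exponents = ℤSolver.solve-∀

    X₁*X₂≡ : X₁ * X₂ ≡ W * X⁻
    X₁*X₂≡ = ^ℤ-*-cong-+ (((+ l ℤ.- + s) ℤ.* + k) ℤ.- + tri k) (+ s ℤ.* ((ℤ.- + l) ℤ.+ + k))
                         (alternatingExp l k) (ℤ.- (+ s ℤ.* + l)) (exponents (+ l) (+ s) (+ k) (+ tri k))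

    expand : ∀ σ X₁ G U B σₛ X₂ C → σ * X₁ * (G * U) * (B - σₛ * X₂ * C)
      ≡ σ * X₁ * U * (G * B) - σₛ * C * (σ * U * G * (X₁ * X₂))
    expand = solve-∀ ℚ-ring

    collect : ∀ σ W′ U C G′ σₛ G W X⁻ → σ * W′ * U * (C * G′) - σₛ * C * (σ * U * G * (W * X⁻))
      ≡ C * (σ * W′ * G′ * U) - σₛ * X⁻ * C * (σ * W * G * U)
    collect = solve-∀ ℚ-ring

  s≤l⇒Σ≤-summand≡0 : ∀ {l s} → s ≤ l → Σ≤ l (summand l s) ≡ 0ℚ
  s≤l⇒Σ≤-summand≡0 {l} {s} s≤l = begin
    Σ≤ l (summand l s)
      ≡⟨ Σ≤-cong l (λ k k≤l → summand-split s≤l k≤l) ⟩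
    Σ≤ l (λ k → C * T₁ k - K * T₂ k)
      ≡⟨ Σ≤-distrib-minus l (λ k → C * T₁ k) (λ k → K * T₂ k) ⟩
    Σ≤ l (λ k → C * T₁ k) - Σ≤ l (λ k → K * T₂ k)
      ≡⟨ cong₂ _-_ (Σ≤-*ˡ l C T₁) (Σ≤-*ˡ l K T₂) ⟩
    C * Σ≤ l T₁ - K * Σ≤ l T₂
      ≡⟨ cong₂ (λ t u → C * t - K * u) (trans truncate (Σ≤-alternatingTerm (+ l) (l ∸ s))) (Σ≤-alternatingTerm (+ l) l) ⟩
    C * P - K * (- x ^ℤ (+ l)) ^ℕ l
      ≡⟨ cong (λ t → C * P - K * t) [-x^l]^l≡ ⟩
    C * P - K * (P * (σₛ * X⁺))
      ≡⟨ regroup C P σₛ X⁻ X⁺ ⟩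
    C * P - C * P * ((σₛ * σₛ) * (X⁻ * X⁺))
      ≡⟨ cong₂ (λ t u → C * P - C * P * (t * u)) ([-1]^n*[-1]^n≡1 s) (^ℤ-inverseˡ (+ s ℤ.* + l)) ⟩
    C * P - C * P * (1ℚ * 1ℚ)
      ≡⟨ cancel (C * P) ⟩
    0ℚ
      ∎
    where
    C  = qfalling l s
    σₛ = (- 1ℚ) ^ℕ s
    X⁻ = x ^ℤ (ℤ.- (+ s ℤ.* + l))
    X⁺ = x ^ℤ (+ s ℤ.* + l)
    K  = σₛ * X⁻ * C
    T₁ = alternatingTerm (+ l) (l ∸ s)
    T₂ = alternatingTerm (+ l) l
    P  = (- x ^ℤ (+ l)) ^ℕ (l ∸ s)

    truncate : Σ≤ l T₁ ≡ Σ≤ (l ∸ s) T₁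
    truncate = trans (cong (λ t → Σ≤ t T₁) (sym (ℕP.m∸n+n≡m s≤l)))
                     (Σ≤-truncate (l ∸ s) s (λ k l∸s<k → alternatingTerm-vanish (+ l) l∸s<k))

    [-x^l]^l≡ : (- x ^ℤ (+ l)) ^ℕ l ≡ P * (σₛ * X⁺)
    [-x^l]^l≡ = begin
      (- x ^ℕ l) ^ℕ l                        ≡⟨ cong ((- x ^ℕ l) ^ℕ_) (ℕP.m∸n+n≡m s≤l) ⟨
      (- x ^ℕ l) ^ℕ (l ∸ s ℕ.+ s)            ≡⟨ ^ℕ-distribˡ-+-* (- x ^ℕ l) (l ∸ s) s ⟩
      P * (- x ^ℕ l) ^ℕ s                    ≡⟨ cong (P *_) (-‿^ℕ (x ^ℕ l) s) ⟩
      P * (σₛ * (x ^ℕ l) ^ℕ s)               ≡⟨ cong (λ t → P * (σₛ * t)) (^ℕ-*-comm x s l) ⟨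
      P * (σₛ * x ^ℕ (s ℕ.* l))              ≡⟨ cong (λ t → P * (σₛ * x ^ℤ t)) (ℤP.pos-* s l) ⟩
      P * (σₛ * X⁺)                          ∎

    regroup : ∀ C P σₛ X⁻ X⁺ → C * P - σₛ * X⁻ * C * (P * (σₛ * X⁺)) ≡ C * P - C * P * ((σₛ * σₛ) * (X⁻ * X⁺))
    regroup = solve-∀ ℚ-ring

    cancel : ∀ a → a - a * (1ℚ * 1ℚ) ≡ 0ℚ
    cancel = solve-∀ ℚ-ring

  l<s⇒Σ≤-summand≡0 : ∀ {l s} → l < s → Σ≤ l (summand l s) ≡ 0ℚ
  l<s⇒Σ≤-summand≡0 {l} {s} l<s = Σ≤-zero l (λ k k≤l → begin
    summand l s k
      ≡⟨ cong₂ (λ t u → A k * (t - Y k * u))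
               (trans (shifted-qfalling s k≤l) (qfalling-vanish (ℕP.≤-<-trans (ℕP.m∸n≤m l k) l<s)))
               (qfalling-vanish l<s) ⟩
    A k * (0ℚ - Y k * 0ℚ)
      ≡⟨ annihilate (A k) (Y k) ⟩
    0ℚ
      ∎)
    where
    A : ℕ → ℚ
    A k = ((- 1ℚ) ^ℕ k) * (x ^ℤ (((+ l ℤ.- + s) ℤ.* + k) ℤ.- + tri k))
          * Σ≤ k (λ j → (x ^ℤ (+ ((((2 ℕ.* l) ℕ.+ 1 ∸ j) ℕ.* j) / 2))) * gbin q l (l ∸ j) * gbin q (l ∸ j) (l ∸ k))
    Y : ℕ → ℚ
    Y k = ((- 1ℚ) ^ℕ s) * (x ^ℤ (+ s ℤ.* ((ℤ.- + l) ℤ.+ + k)))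
    annihilate : ∀ a y → a * (0ℚ - y * 0ℚ) ≡ 0ℚ
    annihilate = solve-∀ ℚ-ring

  Σ≤-summand≡0 : ∀ l s → Σ≤ l (summand l s) ≡ 0ℚ
  Σ≤-summand≡0 l s = [ s≤l⇒Σ≤-summand≡0 , l<s⇒Σ≤-summand≡0 ]′ (ℕP.≤-<-connex s l)

-- The identity holds for s = 0 as well (both products are empty).
lemma2p11 : (q l s : ℕ) → IsPrimePower q → 1 ≤ s →
    Σ≤ l (λ k →
      ((- 1ℚ) ^ℕ k) * (mq q ^ℤ (((+ l ℤ.- + s) ℤ.* + k) ℤ.- + tri k))
      * Σ≤ k (λ j →
          (mq q ^ℤ (+ ((((2 ℕ.* l) ℕ.+ 1 ∸ j) ℕ.* j) / 2)))
          * gbin q l (l ∸ j) * gbin q (l ∸ j) (l ∸ k))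
      * (Π< s (λ i → 1ℚ - (mq q ^ℤ ((ℤ.- + l) ℤ.+ + k ℤ.+ + i)))
         - ((- 1ℚ) ^ℕ s) * (mq q ^ℤ (+ s ℤ.* ((ℤ.- + l) ℤ.+ + k)))
           * Π< s (λ i → 1ℚ - (mq q ^ℤ ((ℤ.- + l) ℤ.+ + i)))))
    ≡ 0ℚ
lemma2p11 q l s q-prime-power _ = Σ≤-summand≡0 q (-q≢0 1<q) ([-q]^[1+n]≢1 1<q) l s
  where
  1<q = prime-power⇒1<q q-prime-power
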